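{- Let $\lambda=(\lambda_1,\dots,\lambda_r)$ be a composition of $n$ and $t\in\{1,\dots,r\}$, and let $s_t=\sum_{j>t}\lambda_j-\sum_{j<t}\lambda_j$. Then the symmetric discrete interval exchanges $T_{(\lambda_1,\dots,\lambda_r)}$ and $T_{(\lambda_1,\dots,\lambda_{t-1},\lambda_t+|s_t|,\lambda_{t+1},\dots,\lambda_r)}$ have the same number of orbits.
   Context: A composition of $n$ is a finite sequence $(\lambda_1,\dots,\lambda_r)$ of positive integers with sum $n$. For $\llbracket a,b\rrbracket=[a,b]\cap\mathbb{Z}$, define $B_i=\llbracket 1+\sum_{j<i}\lambda_j,\ \sum_{j\le i}\lambda_j\rrbracket$ and $s_i=\sum_{j>i}\lambda_j-\sum_{j<i}\lambda_j$. The symmetric discrete interval exchange $T_\lambda$ is the permutation of $\llbracket 1,n\rrbracket$ given by $T_\lambda(x)=x+s_i$ for $x\in B_i$. -}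

module Defs where

open import Data.Nat using (ℕ; zero; suc; _+_; _∸_; _≤_; _≤ᵇ_; ∣_-_∣)
open import Data.Bool using (Bool; true; false; if_then_else_; _∧_)
open import Data.List using (List; []; _∷_; length; take; drop; upTo; map; updateAt)
open import Data.Bool.ListAction using (all)
open import Data.Nat.ListAction using (sum)
open import Data.List.Relation.Unary.All using (All)
open import Data.Fin using (Fin; toℕ)

IsComposition : List ℕ → Set
IsComposition λs = All (λ l → 1 ≤ l) λs

-- Helper: p is the sum of the blocks before the current one.
-- For x in the current block B_i = [p+1, p+λ_i] we return
--   x + s_i = x + (sum of later blocks) - p,
-- which is computed exactly by truncated subtraction since x ≥ p+1.
-- Points outside [1,n] are left fixed (they never occur in the statement).
T-go : ℕ → List ℕ → ℕ → ℕ
T-go p []       x = x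
T-go p (l ∷ ls) x = if x ≤ᵇ p + l then (x + sum ls) ∸ p else T-go (p + l) ls x

T : List ℕ → ℕ → ℕ
T λs = T-go 0 λs

iter : (ℕ → ℕ) → ℕ → ℕ → ℕ
iter f zero    x = x
iter f (suc k) x = f (iter f k x)

-- s_t for a 0-based index t (t = i-1 for the paper's i):
-- s_t = sum_{j>t} λ_j - sum_{j<t} λ_j ;  its absolute value:
abs-s : (λs : List ℕ) → Fin (length λs) → ℕ
abs-s λs t = ∣ sum (drop (suc (toℕ t)) λs) - sum (take (toℕ t) λs) ∣

-- x ∈ [1,n] is the least element of its T_λ-orbit.  Since T_λ is a
-- permutation of the n-element set [1,n], the orbit of x is
-- {T^k x | k < n}.
isOrbitMin : List ℕ → ℕ → Bool
isOrbitMin λs x = all (λ k → x ≤ᵇ iter (T λs) k x) (upTo (sum λs))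

count : (ℕ → Bool) → List ℕ → ℕ
count P []       = 0
count P (x ∷ xs) = if P x then suc (count P xs) else count P xs

-- Number of orbits of T_λ on [1,n] = number of orbit minima (one per orbit).
numOrbits : List ℕ → ℕ
numOrbits λs = count (isOrbitMin λs) (map suc (upTo (sum λs)))

-- Write λ = pre ++ l ∷ post with L = Σ pre, R = Σ post, n = L + l + R and d = |R − L|; let f = T_λ and let g
-- be the exchange whose middle part is l + d. Opening a gap of d points after c (c = l + R if L ≤ R, c = L if
-- R ≤ L) embeds [1, n] increasingly into [1, n + d]. A block-by-block computation shows that g sends the image
-- of each x to the image of f x, either directly or after one stop in the gap, and that g maps the gap below c.
-- So the g-orbit of an embedded point consists of the images of its f-orbit together with gap points lying
-- above the start: orbit minima correspond under the embedding, and gap points are never orbit minima.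
module Submission where

open import Defs
open import Data.Nat using (ℕ; _+_)
open import Data.List using (List; length; updateAt)
open import Data.Fin using (Fin)
open import Relation.Binary.PropositionalEquality using (_≡_)

open import Data.Bool using (Bool; true; false; if_then_else_) renaming (T to IsTrue)
open import Data.Bool.ListAction using (all)
open import Data.Bool.Properties using (T-≡; ⇔→≡)
open import Data.Empty using (⊥-elim)
open import Data.Fin as Fin using (toℕ; fromℕ<)
open import Data.Fin.Properties using (pigeonhole; toℕ-fromℕ<; toℕ<n)
open import Data.List using ([]; _∷_; _++_; map; upTo; applyUpTo; take; drop; lookup)
open import Data.List.Properties using (map-upTo)
open import Data.List.Relation.Unary.All.Properties using (all⁺; all⁻; applyUpTo⁺₁; applyUpTo⁻)
open import Data.Nat
  using (zero; suc; _∸_; _≤_; _<_; _≤ᵇ_; _≤?_; _<?_; ∣_-_∣; s≤s; s≤s⁻¹; z≤n; z<s; s<s)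
open import Data.Nat.Induction using (<-rec)
open import Data.Nat.ListAction using (sum)
open import Data.Nat.ListAction.Properties using (sum-++)
open import Data.Nat.Properties
open import Algebra.Properties.CommutativeSemigroup +-commutativeSemigroup
  using (xy∙z≈xz∙y; xy∙z≈x∙zy; xy∙z≈y∙xz; xy∙z≈yz∙x; x∙yz≈xz∙y; x∙yz≈y∙xz)
open import Data.Product using (∃-syntax; ∃₂; _×_; _,_; proj₁; proj₂)
open import Data.Sum using (inj₁; inj₂)
open import Function using (id; _∘_; _⇔_; mk⇔; Equivalence)
open import Function.Properties.Equivalence as ⇔ using ()
open import Level using (Level)
open import Relation.Binary.PropositionalEquality
open import Relation.Nullary using (¬_; yes; no)
open import Relation.Nullary.Decidable using (dec-true; dec-false)

private variable
  ℓ : Level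
  A : Set ℓ
  h : ℕ → ℕ
  d k p q x y M N : ℕ

≤⇒≤ᵇ≡true : x ≤ y → (x ≤ᵇ y) ≡ true
≤⇒≤ᵇ≡true = dec-true (_ ≤? _)

>⇒≤ᵇ≡false : y < x → (x ≤ᵇ y) ≡ false
>⇒≤ᵇ≡false y<x = dec-false (_ ≤? _) (<⇒≱ y<x)

T⇔T⇒≡ : ∀ {b₁ b₂} → IsTrue b₁ ⇔ IsTrue b₂ → b₁ ≡ b₂
T⇔T⇒≡ b₁⇔b₂ = ⇔→≡ {z = true} (⇔.trans (⇔.sym T-≡) (⇔.trans b₁⇔b₂ T-≡))

infix 4 _∈[1,_]
_∈[1,_] : ℕ → ℕ → Set
x ∈[1, N ] = 1 ≤ x × x ≤ N

∈[1,]-mono : M ≤ N → x ∈[1, M ] → x ∈[1, N ]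
∈[1,]-mono M≤N (1≤x , x≤M) = 1≤x , ≤-trans x≤M M≤N

iter-+ : ∀ h a b x → iter h (a + b) x ≡ iter h a (iter h b x)
iter-+ h zero    b x = refl
iter-+ h (suc a) b x = cong h (iter-+ h a b x)

iter-eventually-periodic : iter h p x ≡ iter h q x → q ≤ k → iter h k x ≡ iter h (k ∸ q + p) x
iter-eventually-periodic {h} {p} {x} {q} {k} eq q≤k = begin
  iter h k x                  ≡⟨ cong (λ j → iter h j x) (m∸n+n≡m q≤k) ⟨
  iter h (k ∸ q + q) x        ≡⟨ iter-+ h (k ∸ q) q x ⟩
  iter h (k ∸ q) (iter h q x) ≡⟨ cong (iter h (k ∸ q)) eq ⟨
  iter h (k ∸ q) (iter h p x) ≡⟨ iter-+ h (k ∸ q) p x ⟨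
  iter h (k ∸ q + p) x        ∎
  where open ≡-Reasoning

-- isOrbitMin λs and numOrbits λs are definitionally isOrbitMinOn (T λs) (sum λs) and numOrbitsOn (T λs) (sum λs).
isOrbitMinOn : (ℕ → ℕ) → ℕ → ℕ → Bool
isOrbitMinOn h N x = all (λ k → x ≤ᵇ iter h k x) (upTo N)

numOrbitsOn : (ℕ → ℕ) → ℕ → ℕ
numOrbitsOn h N = count (isOrbitMinOn h N) (map suc (upTo N))

isOrbitMinOn⇔ : IsTrue (isOrbitMinOn h N x) ⇔ (∀ {k} → k < N → x ≤ iter h k x)
isOrbitMinOn⇔ {h} {N} {x} = mk⇔
  (λ min {k} k<N → ≤ᵇ⇒≤ x _ (applyUpTo⁻ id N (all⁺ below? (upTo N) min) k<N))
  (λ below → all⁻ below? (applyUpTo⁺₁ id N (≤⇒≤ᵇ ∘ below)))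
  where below? = λ k → x ≤ᵇ iter h k x

descent⇒isOrbitMinOn≡false : k < N → iter h k x < x → isOrbitMinOn h N x ≡ false
descent⇒isOrbitMinOn≡false {k} {N} {h} {x} k<N descent with isOrbitMinOn h N x in min
... | false = refl
... | true  = ⊥-elim (<⇒≱ descent (Equivalence.to (isOrbitMinOn⇔ {h} {N}) (subst IsTrue (sym min) _) k<N))

module _ {h : ℕ → ℕ} {N x : ℕ} (orbit-∈ : ∀ k → iter h k x ∈[1, N ]) where

  private
    label : Fin (suc N) → Fin N
    label i = fromℕ< (∸-monoˡ-< (s≤s (proj₂ (orbit-∈ (toℕ i)))) (proj₁ (orbit-∈ (toℕ i))))

    label-injective : ∀ i j → label i ≡ label j → iter h (toℕ i) x ≡ iter h (toℕ j) x
    label-injective i j eq = ∸-cancelʳ-≡ (proj₁ (orbit-∈ (toℕ i))) (proj₁ (orbit-∈ (toℕ j)))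
      (trans (sym (toℕ-fromℕ< _)) (trans (cong toℕ eq) (toℕ-fromℕ< _)))

  orbit-repeats : ∃₂ λ p q → p < q × q ≤ N × iter h p x ≡ iter h q x
  orbit-repeats with i , j , i<j , eq ← pigeonhole ≤-refl label =
    toℕ i , toℕ j , i<j , s≤s⁻¹ (toℕ<n j) , label-injective i j eq

  iterate-below : ∀ k → ∃[ k′ ] k′ < N × iter h k x ≡ iter h k′ x
  iterate-below = <-rec _ step
    where
    step : ∀ k → (∀ {j} → j < k → ∃[ k′ ] k′ < N × iter h j x ≡ iter h k′ x) →
           ∃[ k′ ] k′ < N × iter h k x ≡ iter h k′ x
    step k below with k <? N
    ... | yes k<N = k , k<N , refl
    ... | no k≮N with p , q , p<q , q≤N , eq ← orbit-repeats
      with q≤k ← ≤-trans q≤N (≮⇒≥ k≮N)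
      with k′ , k′<N , eq′ ← below (subst (k ∸ q + p <_) (m∸n+n≡m q≤k) (+-monoʳ-< (k ∸ q) p<q))
      = k′ , k′<N , trans (iter-eventually-periodic eq q≤k) eq′

  isOrbitMinOn⇔orbitMin : IsTrue (isOrbitMinOn h N x) ⇔ (∀ k → x ≤ iter h k x)
  isOrbitMinOn⇔orbitMin = mk⇔
    (λ min k → let k′ , k′<N , eq = iterate-below k in
      subst (x ≤_) (sym eq) (Equivalence.to (isOrbitMinOn⇔ {h} {N}) min k′<N))
    (λ min → Equivalence.from (isOrbitMinOn⇔ {h} {N}) (λ {k} _ → min k))

count-++ : ∀ (P : ℕ → Bool) xs ys → count P (xs ++ ys) ≡ count P xs + count P ys
count-++ P []       ys = refl
count-++ P (x ∷ xs) ys with P x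
... | true  = cong suc (count-++ P xs ys)
... | false = count-++ P xs ys

count-cong : ∀ {P Q : ℕ → Bool} {f g : ℕ → ℕ} N → (∀ {i} → i < N → P (f i) ≡ Q (g i)) →
             count P (applyUpTo f N) ≡ count Q (applyUpTo g N)
count-cong zero    P≡Q = refl
count-cong {P} {Q} {f} {g} (suc N) P≡Q with P (f 0) | Q (g 0) | P≡Q {0} z<s
... | true  | true  | _ = cong suc (count-cong N (P≡Q ∘ s<s))
... | false | false | _ = count-cong N (P≡Q ∘ s<s)

count-none : ∀ {P : ℕ → Bool} {f : ℕ → ℕ} N → (∀ {i} → i < N → P (f i) ≡ false) →
             count P (applyUpTo f N) ≡ 0
count-none zero    none = refl
count-none {P} {f} (suc N) none with P (f 0) | none {0} z<s
... | false | _ = count-none N (none ∘ s<s)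

applyUpTo-+ : ∀ (f : ℕ → A) a b → applyUpTo f (a + b) ≡ applyUpTo f a ++ applyUpTo (f ∘ (a +_)) b
applyUpTo-+ f zero    b = refl
applyUpTo-+ f (suc a) b = cong (f 0 ∷_) (applyUpTo-+ (f ∘ suc) a b)

insertGap : ℕ → ℕ → ℕ → ℕ
insertGap c d x = if x ≤ᵇ c then x else x + d

InGap : ℕ → ℕ → ℕ → Set
InGap c d y = c < y × y ≤ c + d

module _ {c d : ℕ} where

  insertGap-≤ : x ≤ c → insertGap c d x ≡ x
  insertGap-≤ x≤c rewrite ≤⇒≤ᵇ≡true x≤c = refl

  insertGap-> : c < x → insertGap c d x ≡ x + d
  insertGap-> c<x rewrite >⇒≤ᵇ≡false c<x = refl

  insertGap-mono-≤ : x ≤ y → insertGap c d x ≤ insertGap c d y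
  insertGap-mono-≤ {x} {y} x≤y with x ≤? c | y ≤? c
  ... | yes x≤c | yes y≤c rewrite insertGap-≤ x≤c | insertGap-≤ y≤c = x≤y
  ... | yes x≤c | no  y≰c rewrite insertGap-≤ x≤c | insertGap-> (≰⇒> y≰c) = ≤-trans x≤y (m≤m+n y d)
  ... | no  x≰c | yes y≤c = ⊥-elim (x≰c (≤-trans x≤y y≤c))
  ... | no  x≰c | no  y≰c rewrite insertGap-> (≰⇒> x≰c) | insertGap-> (≰⇒> y≰c) = +-monoˡ-≤ d x≤y

  insertGap-cancel-≤ : insertGap c d x ≤ insertGap c d y → x ≤ y
  insertGap-cancel-≤ {x} {y} ψx≤ψy with x ≤? c | y ≤? c
  ... | yes x≤c | yes y≤c rewrite insertGap-≤ x≤c | insertGap-≤ y≤c = ψx≤ψy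
  ... | yes x≤c | no  y≰c = ≤-trans x≤c (<⇒≤ (≰⇒> y≰c))
  ... | no  x≰c | yes y≤c rewrite insertGap-> (≰⇒> x≰c) | insertGap-≤ y≤c =
    ⊥-elim (x≰c (≤-trans (≤-trans (m≤m+n x d) ψx≤ψy) y≤c))
  ... | no  x≰c | no  y≰c rewrite insertGap-> (≰⇒> x≰c) | insertGap-> (≰⇒> y≰c) =
    +-cancelʳ-≤ d x y ψx≤ψy

  insertGap-∈ : c ≤ N → x ∈[1, N ] → insertGap c d x ∈[1, N + d ]
  insertGap-∈ {N} {x} c≤N (1≤x , x≤N) with x ≤? c
  ... | yes x≤c rewrite insertGap-≤ x≤c = 1≤x , ≤-trans x≤N (m≤m+n N d)
  ... | no  x≰c rewrite insertGap-> (≰⇒> x≰c) = ≤-trans 1≤x (m≤m+n x d) , +-monoˡ-≤ d x≤N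

  count-insertGap : ∀ {P : ℕ → Bool} → c ≤ N → (∀ {y} → InGap c d y → P y ≡ false) →
                    count P (applyUpTo suc (N + d)) ≡ count (P ∘ insertGap c d) (applyUpTo suc N)
  count-insertGap {N} {P} c≤N gap-false with e , refl ← m≤n⇒∃[o]m+o≡n c≤N = begin
    count P (applyUpTo suc (c + e + d))
      ≡⟨ cong (count P ∘ applyUpTo suc) (xy∙z≈x∙zy c e d) ⟩
    count P (applyUpTo suc (c + (d + e)))
      ≡⟨ cong (count P) (trans (applyUpTo-+ suc c (d + e)) (cong (applyUpTo suc c ++_) (applyUpTo-+ _ d e))) ⟩
    count P (below ++ gap ++ above)
      ≡⟨ trans (count-++ P below _) (cong (count P below +_) (count-++ P gap above)) ⟩
    count P below + (count P gap + count P above)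
      ≡⟨ cong₂ _+_ (count-cong c below-fixed)
                   (cong₂ _+_ (count-none d gap-false′) (count-cong e above-shifted)) ⟩
    count (P ∘ ψ) below + count (P ∘ ψ) (applyUpTo (suc ∘ (c +_)) e)
      ≡⟨ count-++ (P ∘ ψ) below _ ⟨
    count (P ∘ ψ) (below ++ applyUpTo (suc ∘ (c +_)) e)
      ≡⟨ cong (count (P ∘ ψ)) (applyUpTo-+ suc c e) ⟨
    count (P ∘ ψ) (applyUpTo suc (c + e)) ∎
    where
    open ≡-Reasoning
    ψ = insertGap c d
    below = applyUpTo suc c
    gap   = applyUpTo (suc ∘ (c +_)) d
    above = applyUpTo (suc ∘ (c +_) ∘ (d +_)) e
    below-fixed : ∀ {i} → i < c → P (suc i) ≡ P (ψ (suc i))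
    below-fixed i<c = cong P (sym (insertGap-≤ i<c))
    gap-false′ : ∀ {i} → i < d → P (suc (c + i)) ≡ false
    gap-false′ {i} i<d = gap-false (s≤s (m≤m+n c i) , subst (_≤ c + d) (+-suc c i) (+-monoʳ-≤ c i<d))
    above-shifted : ∀ {i} → i < e → P (suc (c + (d + i))) ≡ P (ψ (suc (c + i)))
    above-shifted {i} _ = cong P (sym (trans (insertGap-> (s≤s (m≤m+n c i))) (cong suc (xy∙z≈x∙zy c i d))))

data GapStep (g : ℕ → ℕ) (c d y z : ℕ) : Set where
  direct  : g y ≡ z → GapStep g c d y z
  via-gap : InGap c d (g y) → g (g y) ≡ z → GapStep g c d y z

record InducedOffGap (f g : ℕ → ℕ) (n c d : ℕ) : Set where
  field
    c≤n      : c ≤ n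
    f-∈      : ∀ {x} → x ∈[1, n ] → f x ∈[1, n ]
    g-step   : ∀ {x} → x ∈[1, n ] → GapStep g c d (insertGap c d x) (insertGap c d (f x))
    gap-drop : ∀ {y} → InGap c d y → g y ∈[1, c ]

module _ {f g : ℕ → ℕ} {n c d : ℕ} (induced : InducedOffGap f g n c d) where
  open InducedOffGap induced

  private
    ψ = insertGap c d

  module _ {x : ℕ} (x∈ : x ∈[1, n ]) where

    f-orbit-∈ : ∀ j → iter f j x ∈[1, n ]
    f-orbit-∈ zero    = x∈
    f-orbit-∈ (suc j) = f-∈ (f-orbit-∈ j)

    data Shadow (y : ℕ) : Set where
      on-orbit : ∀ j → y ≡ ψ (iter f j x) → Shadow y
      in-gap   : ∀ j → InGap c d y → g y ≡ ψ (iter f (suc j) x) → Shadow y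

    shadow-step : Shadow y → Shadow (g y)
    shadow-step (on-orbit j refl) with g-step (f-orbit-∈ j)
    ... | direct  ψf              = on-orbit (suc j) ψf
    ... | via-gap g-in-gap ψf     = in-gap j g-in-gap ψf
    shadow-step (in-gap j _ ψf)   = on-orbit (suc j) ψf

    g-orbit-shadow : ∀ k → Shadow (iter g k (ψ x))
    g-orbit-shadow zero    = on-orbit 0 refl
    g-orbit-shadow (suc k) = shadow-step (g-orbit-shadow k)

    g-orbit-reaches : ∀ j → ∃[ k ] iter g k (ψ x) ≡ ψ (iter f j x)
    g-orbit-reaches zero = 0 , refl
    g-orbit-reaches (suc j) with k , reached ← g-orbit-reaches j | g-step (f-orbit-∈ j)
    ... | direct ψf    = suc k , trans (cong g reached) ψf
    ... | via-gap _ ψf = suc (suc k) , trans (cong (g ∘ g) reached) ψf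

    shadow-∈ : Shadow y → y ∈[1, n + d ]
    shadow-∈ (on-orbit j refl)          = insertGap-∈ c≤n (f-orbit-∈ j)
    shadow-∈ (in-gap _ (c<y , y≤c+d) _) = ≤-trans (s≤s z≤n) c<y , ≤-trans y≤c+d (+-monoˡ-≤ d c≤n)

    g-orbitMin⇔f-orbitMin : (∀ k → ψ x ≤ iter g k (ψ x)) ⇔ (∀ j → x ≤ iter f j x)
    g-orbitMin⇔f-orbitMin = mk⇔ to from
      where
      to : (∀ k → ψ x ≤ iter g k (ψ x)) → ∀ j → x ≤ iter f j x
      to g-min j with k , reached ← g-orbit-reaches j = insertGap-cancel-≤ (subst (ψ x ≤_) reached (g-min k))
      from : (∀ j → x ≤ iter f j x) → ∀ k → ψ x ≤ iter g k (ψ x)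
      from f-min k = above (g-orbit-shadow k)
        where
        above : Shadow y → ψ x ≤ y
        above (on-orbit j refl) = insertGap-mono-≤ (f-min j)
        above {y} (in-gap j y-in-gap ψf) = <⇒≤ (begin-strict
          ψ x                  ≤⟨ insertGap-mono-≤ (f-min (suc j)) ⟩
          ψ (iter f (suc j) x) ≡⟨ ψf ⟨
          g y                  ≤⟨ proj₂ (gap-drop y-in-gap) ⟩
          c                    <⟨ proj₁ y-in-gap ⟩
          y                    ∎)
          where open ≤-Reasoning

    isOrbitMinOn-insertGap : isOrbitMinOn g (n + d) (ψ x) ≡ isOrbitMinOn f n x
    isOrbitMinOn-insertGap = T⇔T⇒≡ (⇔.trans (isOrbitMinOn⇔orbitMin (shadow-∈ ∘ g-orbit-shadow))
                             (⇔.trans g-orbitMin⇔f-orbitMin (⇔.sym (isOrbitMinOn⇔orbitMin f-orbit-∈))))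

  isOrbitMinOn-gap : InGap c d y → isOrbitMinOn g (n + d) y ≡ false
  isOrbitMinOn-gap {y} y-in-gap@(c<y , y≤c+d) = descent⇒isOrbitMinOn≡false 1<n+d gy<y
    where
    gy<y : g y < y
    gy<y = ≤-<-trans (proj₂ (gap-drop y-in-gap)) c<y
    1<n+d : 1 < n + d
    1<n+d = ≤-trans (≤-trans (s≤s (proj₁ (gap-drop y-in-gap))) gy<y) (≤-trans y≤c+d (+-monoˡ-≤ d c≤n))

  numOrbitsOn-induced : numOrbitsOn g (n + d) ≡ numOrbitsOn f n
  numOrbitsOn-induced = begin
    count (isOrbitMinOn g (n + d)) (map suc (upTo (n + d)))
      ≡⟨ cong (count (isOrbitMinOn g (n + d))) (map-upTo suc (n + d)) ⟩
    count (isOrbitMinOn g (n + d)) (applyUpTo suc (n + d))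
      ≡⟨ count-insertGap c≤n isOrbitMinOn-gap ⟩
    count (isOrbitMinOn g (n + d) ∘ ψ) (applyUpTo suc n)
      ≡⟨ count-cong n (λ i<n → isOrbitMinOn-insertGap (s≤s z≤n , i<n)) ⟩
    count (isOrbitMinOn f n) (applyUpTo suc n)
      ≡⟨ cong (count (isOrbitMinOn f n)) (map-upTo suc n) ⟨
    count (isOrbitMinOn f n) (map suc (upTo n)) ∎
    where open ≡-Reasoning

p<x⇒x≰p+0 : p < x → ¬ x ≤ p + 0
p<x⇒x≰p+0 {p} p<x x≤p+0 = <⇒≱ p<x (subst (_ ≤_) (+-identityʳ p) x≤p+0)

T-go-∷-≤ : ∀ p l ls → x ≤ p + l → T-go p (l ∷ ls) x ≡ x + sum ls ∸ p
T-go-∷-≤ p l ls x≤p+l rewrite ≤⇒≤ᵇ≡true x≤p+l = refl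

T-go-∷-> : ∀ p l ls → p + l < x → T-go p (l ∷ ls) x ≡ T-go (p + l) ls x
T-go-∷-> p l ls p+l<x rewrite >⇒≤ᵇ≡false p+l<x = refl

T-go-head : ∀ p l ls → p < x → x ≤ p + l → T-go p (l ∷ ls) x + p ≡ x + sum ls
T-go-head {x} p l ls p<x x≤p+l =
  trans (cong (_+ p) (T-go-∷-≤ p l ls x≤p+l)) (m∸n+n≡m (≤-trans (<⇒≤ p<x) (m≤m+n x (sum ls))))

T-go-++-≤ : ∀ p xs ys → p < x → x ≤ p + sum xs → T-go p (xs ++ ys) x ≡ T-go p xs x + sum ys
T-go-++-≤ p []       ys p<x x≤p+0 = ⊥-elim (p<x⇒x≰p+0 p<x x≤p+0)
T-go-++-≤ {x} p (l ∷ xs) ys p<x x≤ with x ≤? p + l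
... | yes x≤p+l = begin
  T-go p (l ∷ xs ++ ys) x    ≡⟨ T-go-∷-≤ p l (xs ++ ys) x≤p+l ⟩
  x + sum (xs ++ ys) ∸ p     ≡⟨ cong (λ s → x + s ∸ p) (sum-++ xs ys) ⟩
  x + (sum xs + sum ys) ∸ p  ≡⟨ cong (_∸ p) (+-assoc x (sum xs) (sum ys)) ⟨
  x + sum xs + sum ys ∸ p    ≡⟨ +-∸-comm (sum ys) (≤-trans (<⇒≤ p<x) (m≤m+n x (sum xs))) ⟩
  x + sum xs ∸ p + sum ys    ≡⟨ cong (_+ sum ys) (T-go-∷-≤ p l xs x≤p+l) ⟨
  T-go p (l ∷ xs) x + sum ys ∎
  where open ≡-Reasoning
... | no x≰p+l = begin
  T-go p (l ∷ xs ++ ys) x    ≡⟨ T-go-∷-> p l (xs ++ ys) (≰⇒> x≰p+l) ⟩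
  T-go (p + l) (xs ++ ys) x
    ≡⟨ T-go-++-≤ (p + l) xs ys (≰⇒> x≰p+l) (subst (x ≤_) (sym (+-assoc p l (sum xs))) x≤) ⟩
  T-go (p + l) xs x + sum ys ≡⟨ cong (_+ sum ys) (T-go-∷-> p l xs (≰⇒> x≰p+l)) ⟨
  T-go p (l ∷ xs) x + sum ys ∎
  where open ≡-Reasoning

T-go-++-> : ∀ p xs ys → p + sum xs < x → T-go p (xs ++ ys) x ≡ T-go (p + sum xs) ys x
T-go-++-> {x} p []       ys p+0<x = cong (λ q → T-go q ys x) (sym (+-identityʳ p))
T-go-++-> {x} p (l ∷ xs) ys p+l+xs<x = begin
  T-go p (l ∷ xs ++ ys) x      ≡⟨ T-go-∷-> p l (xs ++ ys) (≤-<-trans (+-monoʳ-≤ p (m≤m+n l _)) p+l+xs<x) ⟩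
  T-go (p + l) (xs ++ ys) x    ≡⟨ T-go-++-> (p + l) xs ys (subst (_< x) (sym (+-assoc p l (sum xs))) p+l+xs<x) ⟩
  T-go (p + l + sum xs) ys x   ≡⟨ cong (λ q → T-go q ys x) (+-assoc p l (sum xs)) ⟩
  T-go (p + (l + sum xs)) ys x ∎
  where open ≡-Reasoning

T-go-∈ : ∀ p xs → p < x → x ≤ p + sum xs → T-go p xs x ∈[1, sum xs ]
T-go-∈ p []       p<x x≤p+0 = ⊥-elim (p<x⇒x≰p+0 p<x x≤p+0)
T-go-∈ {x} p (l ∷ xs) p<x x≤ with x ≤? p + l
... | yes x≤p+l = subst (λ v → v ∈[1, l + sum xs ]) (sym (T-go-∷-≤ p l xs x≤p+l)) (head-∈ (sum xs))
  where
  head-∈ : ∀ s → x + s ∸ p ∈[1, l + s ]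
  head-∈ s rewrite +-∸-comm s (<⇒≤ p<x) =
    ≤-trans (m<n⇒0<n∸m p<x) (m≤m+n (x ∸ p) s) ,
    +-monoˡ-≤ s (subst (x ∸ p ≤_) (m+n∸m≡n p l) (∸-monoˡ-≤ p x≤p+l))
... | no x≰p+l
  with 1≤ , ≤sum ← T-go-∈ (p + l) xs (≰⇒> x≰p+l) (subst (x ≤_) (sym (+-assoc p l (sum xs))) x≤) =
  subst (λ v → v ∈[1, l + sum xs ]) (sym (T-go-∷-> p l xs (≰⇒> x≰p+l)))
        (1≤ , ≤-trans ≤sum (m≤n+m (sum xs) l))

T-go-shift : ∀ p xs → p < x → x ≤ p + sum xs → T-go (p + d) xs (x + d) ≡ T-go p xs x
T-go-shift p []       p<x x≤p+0 = ⊥-elim (p<x⇒x≰p+0 p<x x≤p+0)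
T-go-shift {x} {d} p (l ∷ xs) p<x x≤ with x ≤? p + l
... | yes x≤p+l = begin
  T-go (p + d) (l ∷ xs) (x + d)
    ≡⟨ T-go-∷-≤ (p + d) l xs (subst (x + d ≤_) (xy∙z≈xz∙y p l d) (+-monoˡ-≤ d x≤p+l)) ⟩
  x + d + sum xs ∸ (p + d)      ≡⟨ cong₂ _∸_ (xy∙z≈y∙xz x d (sum xs)) (+-comm p d) ⟩
  d + (x + sum xs) ∸ (d + p)    ≡⟨ [m+n]∸[m+o]≡n∸o d (x + sum xs) p ⟩
  x + sum xs ∸ p                ≡⟨ T-go-∷-≤ p l xs x≤p+l ⟨
  T-go p (l ∷ xs) x             ∎
  where open ≡-Reasoning
... | no x≰p+l = begin
  T-go (p + d) (l ∷ xs) (x + d)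
    ≡⟨ T-go-∷-> (p + d) l xs (subst (_< x + d) (xy∙z≈xz∙y p l d) (+-monoˡ-< d (≰⇒> x≰p+l))) ⟩
  T-go (p + d + l) xs (x + d)   ≡⟨ cong (λ q → T-go q xs (x + d)) (xy∙z≈xz∙y p l d) ⟨
  T-go (p + l + d) xs (x + d)
    ≡⟨ T-go-shift (p + l) xs (≰⇒> x≰p+l) (subst (x ≤_) (sym (+-assoc p l (sum xs))) x≤) ⟩
  T-go (p + l) xs x             ≡⟨ T-go-∷-> p l xs (≰⇒> x≰p+l) ⟨
  T-go p (l ∷ xs) x             ∎
  where open ≡-Reasoning

T-∈ : ∀ λs → x ∈[1, sum λs ] → T λs x ∈[1, sum λs ]
T-∈ λs (1≤x , x≤n) = T-go-∈ 0 λs 1≤x x≤n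

module Blocks (pre post : List ℕ) (m : ℕ) where

  T-left : 1 ≤ x → x ≤ sum pre → T (pre ++ m ∷ post) x ≡ T pre x + (m + sum post)
  T-left = T-go-++-≤ 0 pre (m ∷ post)

  T-middle : sum pre < x → x ≤ sum pre + m → T (pre ++ m ∷ post) x + sum pre ≡ x + sum post
  T-middle L<x x≤L+m =
    trans (cong (_+ sum pre) (T-go-++-> 0 pre (m ∷ post) L<x)) (T-go-head (sum pre) m post L<x x≤L+m)

  T-right : sum pre + m < x → T (pre ++ m ∷ post) x ≡ T-go (sum pre + m) post x
  T-right L+m<x = trans (T-go-++-> 0 pre (m ∷ post) (≤-<-trans (m≤m+n (sum pre) m) L+m<x))
                        (T-go-∷-> (sum pre) m post L+m<x)

a+b≡c+[b+d]⇒a≡c+d : ∀ a b c d → a + b ≡ c + (b + d) → a ≡ c + d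
a+b≡c+[b+d]⇒a≡c+d a b c d eq = +-cancelʳ-≡ b a (c + d) (trans eq (x∙yz≈xz∙y c b d))

a+[b+d]≡c+b⇒a+d≡c : ∀ a b c d → a + (b + d) ≡ c + b → a + d ≡ c
a+[b+d]≡c+b⇒a+d≡c a b c d eq = +-cancelʳ-≡ b (a + d) c (trans (xy∙z≈x∙zy a d b) eq)

a+[b+c+d]≡a+[b+d]+c : ∀ a b c d → a + (b + c + d) ≡ a + (b + d) + c
a+[b+c+d]≡a+[b+d]+c a b c d = trans (cong (a +_) (xy∙z≈xz∙y b c d)) (sym (+-assoc a (b + d) c))

module Widening (pre post : List ℕ) (l d : ℕ) where
  private
    module F = Blocks pre post l
    module G = Blocks pre post (l + d)

  L R n : ℕ
  L = sum pre
  R = sum post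
  n = L + (l + R)

  f g : ℕ → ℕ
  f = T (pre ++ l ∷ post)
  g = T (pre ++ (l + d) ∷ post)

  f-∈ : x ∈[1, n ] → f x ∈[1, n ]
  f-∈ {x} = subst (λ N → x ∈[1, N ] → f x ∈[1, N ]) (sum-++ pre (l ∷ post)) (T-∈ (pre ++ l ∷ post))

  g-left : x ∈[1, L ] → g x ≡ f x + d
  g-left {x} (1≤x , x≤L) rewrite F.T-left 1≤x x≤L | G.T-left 1≤x x≤L = a+[b+c+d]≡a+[b+d]+c (T pre x) l d R

  f-left-> : x ∈[1, L ] → l + R < f x
  f-left-> {x} (1≤x , x≤L) rewrite F.T-left 1≤x x≤L = +-monoˡ-≤ (l + R) (proj₁ (T-go-∈ 0 pre 1≤x x≤L))

  f-middle : L < x → x ≤ L + l → f x + L ≡ x + R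
  f-middle = F.T-middle

  g-middle : L < x → x ≤ L + (l + d) → g x + L ≡ x + R
  g-middle = G.T-middle

  f-middle-≤ : L < x → x ≤ L + l → f x ≤ l + R
  f-middle-≤ {x} L<x x≤L+l = +-cancelʳ-≤ L (f x) (l + R) (begin
    f x + L   ≡⟨ f-middle L<x x≤L+l ⟩
    x + R     ≤⟨ +-monoˡ-≤ R x≤L+l ⟩
    L + l + R ≡⟨ xy∙z≈yz∙x L l R ⟩
    l + R + L ∎)
    where open ≤-Reasoning

  g-middle≡f : L < x → x ≤ L + l → g x ≡ f x
  g-middle≡f L<x x≤L+l = +-cancelʳ-≡ L _ _
    (trans (g-middle L<x (≤-trans x≤L+l (+-monoʳ-≤ L (m≤m+n l d)))) (sym (f-middle L<x x≤L+l)))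

  g-right-∈ : L + (l + d) < x → x ≤ L + (l + d) + R → g x ∈[1, R ]
  g-right-∈ L+l+d<x x≤ rewrite G.T-right L+l+d<x = T-go-∈ (L + (l + d)) post L+l+d<x x≤

  f-right-∈ : L + l < x → x ≤ n → f x ∈[1, R ]
  f-right-∈ {x} L+l<x x≤n rewrite F.T-right L+l<x =
    T-go-∈ (L + l) post L+l<x (subst (x ≤_) (sym (+-assoc L l R)) x≤n)

  g-right-shift : L + l < x → x ≤ n → g (x + d) ≡ f x
  g-right-shift {x} L+l<x x≤n = begin
    g (x + d)                       ≡⟨ G.T-right (subst (_< x + d) (+-assoc L l d) (+-monoˡ-< d L+l<x)) ⟩
    T-go (L + (l + d)) post (x + d) ≡⟨ cong (λ p → T-go p post (x + d)) (+-assoc L l d) ⟨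
    T-go (L + l + d) post (x + d)   ≡⟨ T-go-shift (L + l) post L+l<x (subst (x ≤_) (sym (+-assoc L l R)) x≤n) ⟩
    T-go (L + l) post x             ≡⟨ F.T-right L+l<x ⟨
    f x                             ∎
    where open ≡-Reasoning

  -- The gap is the first d points of the last block of g, which g maps into [1, R].
  module _ (R≡L+d : R ≡ L + d) where
    private
      c = L + (l + d)
      ψ = insertGap c d

      c≡l+R : c ≡ l + R
      c≡l+R = trans (x∙yz≈y∙xz L l d) (cong (l +_) (sym R≡L+d))

      R≤c : R ≤ c
      R≤c = subst (R ≤_) (sym c≡l+R) (m≤n+m R l)

      c≤n : c ≤ n
      c≤n = subst (_≤ n) (sym c≡l+R) (m≤n+m (l + R) L)

      g-middle-shift : L < x → x ≤ c → g x ≡ x + d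
      g-middle-shift {x} L<x x≤c =
        a+b≡c+[b+d]⇒a≡c+d (g x) L x d (subst (λ r → g x + L ≡ x + r) R≡L+d (g-middle L<x x≤c))

      step-left : x ∈[1, L ] → GapStep g c d (ψ x) (ψ (f x))
      step-left {x} x∈@(_ , x≤L) = direct (begin
        g (ψ x) ≡⟨ cong g (insertGap-≤ (≤-trans x≤L (m≤m+n L (l + d)))) ⟩
        g x     ≡⟨ g-left x∈ ⟩
        f x + d ≡⟨ insertGap-> (subst (_< f x) (sym c≡l+R) (f-left-> x∈)) ⟨
        ψ (f x) ∎)
        where open ≡-Reasoning

      step-middle : L < x → x ≤ L + l → GapStep g c d (ψ x) (ψ (f x))
      step-middle {x} L<x x≤L+l = direct (begin
        g (ψ x) ≡⟨ cong g (insertGap-≤ (≤-trans x≤L+l (+-monoʳ-≤ L (m≤m+n l d)))) ⟩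
        g x     ≡⟨ g-middle≡f L<x x≤L+l ⟩
        f x     ≡⟨ insertGap-≤ (subst (f x ≤_) (sym c≡l+R) (f-middle-≤ L<x x≤L+l)) ⟨
        ψ (f x) ∎)
        where open ≡-Reasoning

      step-crossing : L + l < x → x ≤ c → GapStep g c d (ψ x) (ψ (f x))
      step-crossing {x} L+l<x x≤c = via-gap (subst (InGap c d) (sym gψx≡x+d) (c<x+d , +-monoˡ-≤ d x≤c)) (begin
        g (g (ψ x)) ≡⟨ cong g gψx≡x+d ⟩
        g (x + d)   ≡⟨ g-right-shift L+l<x x≤n ⟩
        f x         ≡⟨ insertGap-≤ (≤-trans (proj₂ (f-right-∈ L+l<x x≤n)) R≤c) ⟨
        ψ (f x)     ∎)
        where
        open ≡-Reasoning
        x≤n = ≤-trans x≤c c≤n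
        c<x+d : c < x + d
        c<x+d = subst (_< x + d) (+-assoc L l d) (+-monoˡ-< d L+l<x)
        gψx≡x+d : g (ψ x) ≡ x + d
        gψx≡x+d = trans (cong g (insertGap-≤ x≤c)) (g-middle-shift (≤-<-trans (m≤m+n L l) L+l<x) x≤c)

      step-right : c < x → x ≤ n → GapStep g c d (ψ x) (ψ (f x))
      step-right {x} c<x x≤n = direct (begin
        g (ψ x)   ≡⟨ cong g (insertGap-> c<x) ⟩
        g (x + d) ≡⟨ g-right-shift L+l<x x≤n ⟩
        f x       ≡⟨ insertGap-≤ (≤-trans (proj₂ (f-right-∈ L+l<x x≤n)) R≤c) ⟨
        ψ (f x)   ∎)
        where
        open ≡-Reasoning
        L+l<x = ≤-<-trans (+-monoʳ-≤ L (m≤m+n l d)) c<x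

      gap-drop : InGap c d y → g y ∈[1, c ]
      gap-drop (c<y , y≤c+d) = ∈[1,]-mono R≤c (g-right-∈ c<y (≤-trans y≤c+d (+-monoʳ-≤ c d≤R)))
        where d≤R = subst (d ≤_) (sym R≡L+d) (m≤n+m d L)

    inducedOffGap-R≡L+d : InducedOffGap f g n (L + (l + d)) d
    inducedOffGap-R≡L+d = record { c≤n = c≤n ; f-∈ = f-∈ ; g-step = g-step ; gap-drop = gap-drop }
      where
      g-step : x ∈[1, n ] → GapStep g c d (ψ x) (ψ (f x))
      g-step {x} x∈@(_ , x≤n) with x ≤? L | x ≤? L + l | x ≤? c
      ... | yes x≤L | _         | _       = step-left (proj₁ x∈ , x≤L)
      ... | no  x≰L | yes x≤L+l | _       = step-middle (≰⇒> x≰L) x≤L+l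
      ... | no  _   | no  x≰L+l | yes x≤c = step-crossing (≰⇒> x≰L+l) x≤c
      ... | no  _   | no  _     | no  x≰c = step-right (≰⇒> x≰c) x≤n

  -- The gap is the first d points of the middle block of g, which g moves down by d.
  module _ (L≡R+d : L ≡ R + d) where
    private
      ψ = insertGap L d

      R≤L : R ≤ L
      R≤L = subst (R ≤_) (sym L≡R+d) (m≤m+n R d)

      g-middle-unshift : L < x → x ≤ L + (l + d) → g x + d ≡ x
      g-middle-unshift {x} L<x x≤ =
        a+[b+d]≡c+b⇒a+d≡c (g x) R x d (subst (λ L′ → g x + L′ ≡ x + R) L≡R+d (g-middle L<x x≤))

      f-middle-unshift : L < x → x ≤ L + l → f x + d ≡ x
      f-middle-unshift {x} L<x x≤ =
        a+[b+d]≡c+b⇒a+d≡c (f x) R x d (subst (λ L′ → f x + L′ ≡ x + R) L≡R+d (f-middle L<x x≤))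

      gψ-middle : L < x → x ≤ L + l → g (ψ x) ≡ x
      gψ-middle {x} L<x x≤L+l = +-cancelʳ-≡ d _ _ (trans (cong (λ y → g y + d) (insertGap-> L<x))
        (g-middle-unshift (≤-trans L<x (m≤m+n x d)) (subst (x + d ≤_) (+-assoc L l d) (+-monoˡ-≤ d x≤L+l))))

      step-left : x ∈[1, L ] → GapStep g L d (ψ x) (ψ (f x))
      step-left {x} x∈@(_ , x≤L) with f x ≤? L
      ... | no fx≰L = direct (begin
        g (ψ x) ≡⟨ cong g (insertGap-≤ x≤L) ⟩
        g x     ≡⟨ g-left x∈ ⟩
        f x + d ≡⟨ insertGap-> (≰⇒> fx≰L) ⟨
        ψ (f x) ∎)
        where open ≡-Reasoning
      ... | yes fx≤L = via-gap (subst (InGap L d) (sym gψx≡fx+d) (L<fx+d , +-monoˡ-≤ d fx≤L)) (begin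
        g (g (ψ x)) ≡⟨ cong g gψx≡fx+d ⟩
        g (f x + d) ≡⟨ +-cancelʳ-≡ d _ _ (g-middle-unshift L<fx+d fx+d≤) ⟩
        f x         ≡⟨ insertGap-≤ fx≤L ⟨
        ψ (f x)     ∎)
        where
        open ≡-Reasoning
        gψx≡fx+d : g (ψ x) ≡ f x + d
        gψx≡fx+d = trans (cong g (insertGap-≤ x≤L)) (g-left x∈)
        L<fx+d : L < f x + d
        L<fx+d = subst (_< f x + d) (sym L≡R+d) (+-monoˡ-< d (≤-<-trans (m≤n+m R l) (f-left-> x∈)))
        fx+d≤ : f x + d ≤ L + (l + d)
        fx+d≤ = ≤-trans (+-monoˡ-≤ d fx≤L) (+-monoʳ-≤ L (m≤n+m d l))

      step-middle : L < x → x ≤ L + l → GapStep g L d (ψ x) (ψ (f x))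
      step-middle {x} L<x x≤L+l with x ≤? L + d
      ... | no x≰L+d = direct (begin
        g (ψ x) ≡⟨ gψ-middle L<x x≤L+l ⟩
        x       ≡⟨ f-middle-unshift L<x x≤L+l ⟨
        f x + d ≡⟨ insertGap-> L<fx ⟨
        ψ (f x) ∎)
        where
        open ≡-Reasoning
        L<fx : L < f x
        L<fx = +-cancelʳ-< d L (f x) (subst (L + d <_) (sym (f-middle-unshift L<x x≤L+l)) (≰⇒> x≰L+d))
      ... | yes x≤L+d = via-gap (subst (InGap L d) (sym (gψ-middle L<x x≤L+l)) (L<x , x≤L+d)) (begin
        g (g (ψ x)) ≡⟨ cong g (gψ-middle L<x x≤L+l) ⟩
        g x         ≡⟨ g-middle≡f L<x x≤L+l ⟩
        f x         ≡⟨ insertGap-≤ fx≤L ⟨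
        ψ (f x)     ∎)
        where
        open ≡-Reasoning
        fx≤L : f x ≤ L
        fx≤L = +-cancelʳ-≤ d (f x) L (subst (_≤ L + d) (sym (f-middle-unshift L<x x≤L+l)) x≤L+d)

      step-right : L + l < x → x ≤ n → GapStep g L d (ψ x) (ψ (f x))
      step-right {x} L+l<x x≤n = direct (begin
        g (ψ x)   ≡⟨ cong g (insertGap-> (≤-<-trans (m≤m+n L l) L+l<x)) ⟩
        g (x + d) ≡⟨ g-right-shift L+l<x x≤n ⟩
        f x       ≡⟨ insertGap-≤ (≤-trans (proj₂ (f-right-∈ L+l<x x≤n)) R≤L) ⟨
        ψ (f x)   ∎)
        where open ≡-Reasoning

      gap-drop : InGap L d y → g y ∈[1, L ]
      gap-drop {y} (L<y , y≤L+d) =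
        +-cancelʳ-< d 0 (g y) (subst (d <_) (sym gy+d≡y) (≤-<-trans d≤L L<y)) ,
        +-cancelʳ-≤ d (g y) L (subst (_≤ L + d) (sym gy+d≡y) y≤L+d)
        where
        d≤L = subst (d ≤_) (sym L≡R+d) (m≤n+m d R)
        gy+d≡y : g y + d ≡ y
        gy+d≡y = g-middle-unshift L<y (≤-trans y≤L+d (+-monoʳ-≤ L (m≤n+m d l)))

    inducedOffGap-L≡R+d : InducedOffGap f g n L d
    inducedOffGap-L≡R+d = record { c≤n = m≤m+n L (l + R) ; f-∈ = f-∈ ; g-step = g-step ; gap-drop = gap-drop }
      where
      g-step : x ∈[1, n ] → GapStep g L d (ψ x) (ψ (f x))
      g-step {x} x∈@(_ , x≤n) with x ≤? L | x ≤? L + l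
      ... | yes x≤L | _         = step-left (proj₁ x∈ , x≤L)
      ... | no  x≰L | yes x≤L+l = step-middle (≰⇒> x≰L) x≤L+l
      ... | no  _   | no  x≰L+l = step-right (≰⇒> x≰L+l) x≤n

  numOrbits-widen : ∀ {c} → InducedOffGap f g n c d →
                    numOrbits (pre ++ (l + d) ∷ post) ≡ numOrbits (pre ++ l ∷ post)
  numOrbits-widen induced = begin
    numOrbitsOn g (sum (pre ++ (l + d) ∷ post))
      ≡⟨ cong (numOrbitsOn g) (trans (sum-++ pre _) (a+[b+c+d]≡a+[b+d]+c L l d R)) ⟩
    numOrbitsOn g (n + d)                       ≡⟨ numOrbitsOn-induced induced ⟩
    numOrbitsOn f n                             ≡⟨ cong (numOrbitsOn f) (sum-++ pre (l ∷ post)) ⟨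
    numOrbitsOn f (sum (pre ++ l ∷ post))       ∎
    where open ≡-Reasoning

numOrbits-widen-by-∣s∣ : ∀ pre post l →
  numOrbits (pre ++ l ∷ post) ≡ numOrbits (pre ++ (l + ∣ sum post - sum pre ∣) ∷ post)
numOrbits-widen-by-∣s∣ pre post l with ≤-total (sum pre) (sum post)
... | inj₁ L≤R rewrite m≤n⇒∣n-m∣≡n∸m L≤R =
  sym (numOrbits-widen (inducedOffGap-R≡L+d (sym (m+[n∸m]≡n L≤R))))
  where open Widening pre post l (sum post ∸ sum pre)
... | inj₂ R≤L rewrite m≤n⇒∣m-n∣≡n∸m R≤L =
  sym (numOrbits-widen (inducedOffGap-L≡R+d (sym (m+[n∸m]≡n R≤L))))
  where open Widening pre post l (sum pre ∸ sum post)

updateAt-split : ∀ (xs : List A) i h →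
                 updateAt xs i h ≡ take (toℕ i) xs ++ h (lookup xs i) ∷ drop (suc (toℕ i)) xs
updateAt-split (x ∷ xs) Fin.zero    h = refl
updateAt-split (x ∷ xs) (Fin.suc i) h = cong (x ∷_) (updateAt-split xs i h)

split-at : ∀ (xs : List A) i → xs ≡ take (toℕ i) xs ++ lookup xs i ∷ drop (suc (toℕ i)) xs
split-at (x ∷ xs) Fin.zero    = refl
split-at (x ∷ xs) (Fin.suc i) = cong (x ∷_) (split-at xs i)

lemma4 : (λs : List ℕ) → IsComposition λs → (t : Fin (length λs)) →
    numOrbits λs ≡ numOrbits (updateAt λs t (λ l → l + abs-s λs t))
lemma4 λs _ t = begin
  numOrbits λs                                      ≡⟨ cong numOrbits (split-at λs t) ⟩
  numOrbits (pre ++ λt ∷ post)                      ≡⟨ numOrbits-widen-by-∣s∣ pre post λt ⟩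
  numOrbits (pre ++ (λt + abs-s λs t) ∷ post)       ≡⟨ cong numOrbits (updateAt-split λs t _) ⟨
  numOrbits (updateAt λs t (λ l → l + abs-s λs t))  ∎
  where
  open ≡-Reasoning
  pre  = take (toℕ t) λs
  λt   = lookup λs t
  post = drop (suc (toℕ t)) λs
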